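{- For every network $M$ of the calculus CaIT there is $z\in\mathbb N$ such that whenever $M\to_i^u N$ (a sequence of $u$ consecutive reductions $\to_i$) for some network $N$, then $u\le z$. Here $\to_i\;=\;\to_\tau\cup\bigcup_a\to_a$ (union over all actuators $a$).
   Context: The calculus CaIT. Fix a set of locations with a distance $d(h,k)\in\mathbb N$ between locations, a constant $\delta\in\mathbb N$, and a function $\mathrm{rng}$ giving each channel $c$ a range $\mathrm{rng}(c)\in\mathbb N\cup\{ -1,\infty\}$. Values $v,w$ include basic values, sensor/actuator values and locations; boolean guards $b$ are decidable. Processes: $P,Q::=\mathsf{nil}\mid \rho.P\mid P\parallel Q\mid \lfloor\pi.P\rfloor Q\mid [b]P;Q\mid X\mid \mathsf{fix}\,X.P$ with $\rho\in\{\sigma,\ @(x),\ s?(x),\ a!v\}$ ($s$ a sensor, $a$ an actuator) and $\pi\in\{\overline{c}\langle v\rangle,\ c(x)\}$. The variable $x$ is bound in $c(x).P$, $s?(x).P$, $@(x).P$ and $X$ in $\mathsf{fix}X.P$; in $\sigma.Q$ and $\lfloor\pi.P\rfloor Q$ the occurrence of $Q$ is time-guarded, and in $\mathsf{fix}X.P$ all occurrences of $X$ must be time-guarded. Networks: $M,N::=\mathbf 0\mid n[\mathcal I\bowtie P]^{\mu}_{h}\mid M\mid N\mid (\nu c)M$, where $n$ is a node name, $\mathcal I$ a partial map from sensor and actuator names to values (physical interface), $\mu\in\{\mathsf s,\mathsf m\}$ (stationary/mobile) and $h$ a location. Sensors are node-dependent or location-dependent. Networks are closed and well-formed: node names are distinct;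 distinct nodes have distinct actuators and distinct node-dependent sensors; if $P$ in $n[\mathcal I\bowtie P]^\mu_h$ contains $s?(x)$ (resp. $a!v$) then $\mathcal I(s)$ (resp. $\mathcal I(a)$) is defined; a node whose interface defines a location-dependent sensor is stationary. $\prod$ denotes iterated parallel composition, with empty product $\mathsf{nil}$ or $\mathbf 0$; $T\{v/x\}$ is substitution. Structural congruence $\equiv$ is the least congruence with: $\parallel$ commutative, associative, unit $\mathsf{nil}$; $[b]P;Q\equiv P$ if $b$ true, $\equiv Q$ if $b$ false; $\mathsf{fix}X.P\equiv P\{\mathsf{fix}X.P/X\}$; $P\equiv Q$ implies $n[\mathcal I\bowtie P]^\mu_h\equiv n[\mathcal I\bowtie Q]^\mu_h$; network $\mid$ commutative, associative, unit $\mathbf 0$; $(\nu c)\mathbf 0\equiv\mathbf 0$; $(\nu c)(\nu d)M\equiv(\nu d)(\nu c)M$; $(\nu c)(M\mid N)\equiv M\mid(\nu c)N$ if $c$ not in $M$. Reduction relations $\to_\tau$, $\to_a$ ($a$ an actuator), $\to_\sigma$ are the least relations closed under: (pos) $n[\mathcal I\bowtie @(x).P]^\mu_h\to_\tau n[\mathcal I\bowtie P\{h/x\}]^\mu_h$; (sensread) if $\mathcal I(s)=v$, $n[\mathcal I\bowtie s?(x).P]^\mu_h\to_\tau n[\mathcal I\bowtie P\{v/x\}]^\mu_h$; (actunchg) if $\mathcal I(a)=v$, $n[\mathcal I\bowtie a!v.P]^\mu_h\to_\tau n[\mathcal I\bowtie P]^\mu_h$; (actchg) if $\mathcal I(a)\ne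 v$, $n[\mathcal I\bowtie a!v.P]^\mu_h\to_a n[\mathcal I[a\mapsto v]\bowtie P]^\mu_h$; (loccom) if $\mathrm{rng}(c)=-1$, $n[\mathcal I\bowtie \lfloor\overline c\langle v\rangle.P\rfloor R\parallel\lfloor c(x).Q\rfloor S]^\mu_h\to_\tau n[\mathcal I\bowtie P\parallel Q\{v/x\}]^\mu_h$; (timestat) if $N=n[\mathcal I\bowtie \prod_i\lfloor\pi_i.P_i\rfloor Q_i\parallel\prod_j\sigma.R_j]^{\mathsf s}_h$ has no $\to_\tau$ reduction then $N\to_\sigma n[\mathcal I\bowtie\prod_iQ_i\parallel\prod_jR_j]^{\mathsf s}_h$; (timemob) likewise for $\mu=\mathsf m$, with result located at any $k$ with $d(h,k)\le\delta$; (glbcom) if $d(h,k)\le\mathrm{rng}(c)$, $n[\mathcal I\bowtie\lfloor\overline c\langle v\rangle.P\rfloor R]^{\mu_1}_h\mid m[\mathcal J\bowtie\lfloor c(x).Q\rfloor S]^{\mu_2}_k\to_\tau n[\mathcal I\bowtie P]^{\mu_1}_h\mid m[\mathcal J\bowtie Q\{v/x\}]^{\mu_2}_k$; (parp) for $\omega\in\{\tau,a\}$, if $\prod_i n_i[\mathcal I_i\bowtie P_i]^{\mu_i}_{h_i}\to_\omega\prod_i n_i[\mathcal I'_i\bowtie P'_i]^{\mu'_i}_{h'_i}$ then $\prod_i n_i[\mathcal I_i\bowtie P_i\parallel Q_i]^{\mu_i}_{h_i}\to_\omega\prod_i n_i[\mathcal I'_i\bowtie P'_i\parallel Q_i]^{\mu'_i}_{h'_i}$;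 (parn) for $\omega\in\{\tau,a\}$, $M\to_\omega M'$ implies $M\mid N\to_\omega M'\mid N$; (timepar) $M\to_\sigma M'$, $N\to_\sigma N'$ and $M\mid N$ has no $\to_\tau$ reduction imply $M\mid N\to_\sigma M'\mid N'$; (timezero) $\mathbf 0\to_\sigma\mathbf 0$; (res) $M\to_\omega N$ implies $(\nu c)M\to_\omega(\nu c)N$ for $\omega\in\{\tau,a,\sigma\}$; (struct) $M\equiv N\to_\omega N'\equiv M'$ implies $M\to_\omega M'$. -}

module Defs where

open import Data.Nat using (ℕ; zero; suc; _≤_)
open import Data.Fin using (Fin; zero; suc)
open import Data.Bool using (Bool; true; false; if_then_else_)
open import Data.Maybe using (Maybe; just; nothing)
open import Data.Product using (Σ; ∃; ∃-syntax; _×_; _,_; proj₁; proj₂)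
open import Data.Unit using (⊤)
open import Data.Sum using (_⊎_)
open import Data.Empty using (⊥)
open import Data.List using (List; []; _∷_; _++_; length; lookup)
open import Data.Vec using (Vec; []; _∷_)
open import Relation.Nullary using (¬_; does)
open import Relation.Binary.PropositionalEquality using (_≡_; _≢_)
open import Relation.Binary.Definitions using (DecidableEquality)

data Range : Set where
  local : Range          -- rng(c) = -1 (local channel)
  fin   : ℕ → Range
  inf   : Range

_≤R_ : ℕ → Range → Set
n ≤R local = ⊥
n ≤R fin r = n ≤ r
n ≤R inf   = ⊤

record Params : Set₁ where
  field
    Loc    : Set
    dist   : Loc → Loc → ℕ
    δ      : ℕ                      -- mobility constant
    Val    : Set
    loc    : Loc → Val
    Chan   : Set
    rng    : Chan → Range
    Sens   : Set
    locDep : Sens → Bool            -- true: location-dependent; false: node-dependent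
    Act    : Set
    _≟A_   : DecidableEquality Act
    Name   : Set

module CaIT (Π : Params) where
  open Params Π

  -- Syntax (scoped de Bruijn: n value variables, p process variables)

  data Tm (n : ℕ) : Set where
    var : Fin n → Tm n
    val : Val → Tm n

  Guard : ℕ → Set
  Guard n = (Fin n → Val) → Bool

  data Proc (n p : ℕ) : Set where
    nil    : Proc n p
    tick   : Proc n p → Proc n p                         -- σ.P
    atx    : Proc (suc n) p → Proc n p                   -- @(x).P
    sread  : Sens → Proc (suc n) p → Proc n p
    awrite : Act → Tm n → Proc n p → Proc n p
    _∥_    : Proc n p → Proc n p → Proc n p
    outT   : Chan → Tm n → Proc n p → Proc n p → Proc n p          -- ⌊c̄⟨v⟩.P⌋Q
    inT    : Chan → Proc (suc n) p → Proc n p → Proc n p           -- ⌊c(x).P⌋Q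
    cond   : Guard n → Proc n p → Proc n p → Proc n p
    pvar   : Fin p → Proc n p
    fix    : Proc n (suc p) → Proc n p

  infixr 5 _∥_

  wkTm : ∀ {n} → Tm n → Tm (suc n)
  wkTm (var i) = var (suc i)
  wkTm (val v) = val v

  extV : ∀ {n m} → (Fin n → Tm m) → Fin (suc n) → Tm (suc m)
  extV s zero    = var zero
  extV s (suc i) = wkTm (s i)

  substTm : ∀ {n m} → (Fin n → Tm m) → Tm n → Tm m
  substTm s (var i) = s i
  substTm s (val v) = val v

  evalTm : ∀ {m} → (Fin m → Val) → Tm m → Val
  evalTm ρ (var i) = ρ i
  evalTm ρ (val v) = v

  substG : ∀ {n m} → (Fin n → Tm m) → Guard n → Guard m
  substG s b ρ = b (λ i → evalTm ρ (s i))

  vsub : ∀ {n m p} → (Fin n → Tm m) → Proc n p → Proc m p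
  vsub s nil            = nil
  vsub s (tick P)       = tick (vsub s P)
  vsub s (atx P)        = atx (vsub (extV s) P)
  vsub s (sread x P)    = sread x (vsub (extV s) P)
  vsub s (awrite a t P) = awrite a (substTm s t) (vsub s P)
  vsub s (P ∥ Q)        = vsub s P ∥ vsub s Q
  vsub s (outT c t P Q) = outT c (substTm s t) (vsub s P) (vsub s Q)
  vsub s (inT c P Q)    = inT c (vsub (extV s) P) (vsub s Q)
  vsub s (cond b P Q)   = cond (substG s b) (vsub s P) (vsub s Q)
  vsub s (pvar X)       = pvar X
  vsub s (fix P)        = fix (vsub s P)

  sub0 : ∀ {n} → Val → Fin (suc n) → Tm n
  sub0 v zero    = val v
  sub0 v (suc i) = var i

  -- P{v/x} for the innermost value variable x
  _[_] : ∀ {n p} → Proc (suc n) p → Val → Proc n p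
  P [ v ] = vsub (sub0 v) P

  extR : ∀ {p q} → (Fin p → Fin q) → Fin (suc p) → Fin (suc q)
  extR f zero    = zero
  extR f (suc i) = suc (f i)

  prename : ∀ {n p q} → (Fin p → Fin q) → Proc n p → Proc n q
  prename f nil            = nil
  prename f (tick P)       = tick (prename f P)
  prename f (atx P)        = atx (prename f P)
  prename f (sread x P)    = sread x (prename f P)
  prename f (awrite a t P) = awrite a t (prename f P)
  prename f (P ∥ Q)        = prename f P ∥ prename f Q
  prename f (outT c t P Q) = outT c t (prename f P) (prename f Q)
  prename f (inT c P Q)    = inT c (prename f P) (prename f Q)
  prename f (cond b P Q)   = cond b (prename f P) (prename f Q)
  prename f (pvar X)       = pvar (f X)
  prename f (fix P)        = fix (prename (extR f) P)

  vweaken : ∀ {n p} → Proc n p → Proc (suc n) p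
  vweaken = vsub (λ i → var (suc i))

  extP : ∀ {n p q} → (Fin p → Proc n q) → Fin (suc p) → Proc n (suc q)
  extP f zero    = pvar zero
  extP f (suc i) = prename suc (f i)

  psub : ∀ {n p q} → (Fin p → Proc n q) → Proc n p → Proc n q
  psub f nil            = nil
  psub f (tick P)       = tick (psub f P)
  psub f (atx P)        = atx (psub (λ i → vweaken (f i)) P)
  psub f (sread x P)    = sread x (psub (λ i → vweaken (f i)) P)
  psub f (awrite a t P) = awrite a t (psub f P)
  psub f (P ∥ Q)        = psub f P ∥ psub f Q
  psub f (outT c t P Q) = outT c t (psub f P) (psub f Q)
  psub f (inT c P Q)    = inT c (psub (λ i → vweaken (f i)) P) (psub f Q)
  psub f (cond b P Q)   = cond b (psub f P) (psub f Q)
  psub f (pvar X)       = f X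
  psub f (fix P)        = fix (psub (extP f) P)

  single : ∀ {n p} → Proc n p → Fin (suc p) → Proc n p
  single Q zero    = Q
  single Q (suc i) = pvar i

  unfold : ∀ {n p} → Proc n (suc p) → Proc n p
  unfold P = psub (single (fix P)) P

  -- Time-guardedness: every occurrence of process variable X in P is
  -- time-guarded (i.e. lies in Q of some σ.Q or ⌊π.P'⌋Q).

  TG : ∀ {n p} → Fin p → Proc n p → Set
  TG X nil            = ⊤
  TG X (tick P)       = ⊤
  TG X (atx P)        = TG X P
  TG X (sread s P)    = TG X P
  TG X (awrite a t P) = TG X P
  TG X (P ∥ Q)        = TG X P × TG X Q
  TG X (outT c t P Q) = TG X P
  TG X (inT c P Q)    = TG X P
  TG X (cond b P Q)   = TG X P × TG X Q
  TG X (pvar Y)       = X ≢ Y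
  TG X (fix P)        = TG (suc X) P

  WFP : ∀ {n p} → Proc n p → Set
  WFP nil            = ⊤
  WFP (tick P)       = WFP P
  WFP (atx P)        = WFP P
  WFP (sread s P)    = WFP P
  WFP (awrite a t P) = WFP P
  WFP (P ∥ Q)        = WFP P × WFP Q
  WFP (outT c t P Q) = WFP P × WFP Q
  WFP (inT c P Q)    = WFP P × WFP Q
  WFP (cond b P Q)   = WFP P × WFP Q
  WFP (pvar Y)       = ⊤
  WFP (fix P)        = TG zero P × WFP P

  data Mob : Set where
    stat mobile : Mob

  record Intf : Set where
    field
      sens : Sens → Maybe Val
      act  : Act → Maybe Val
  open Intf public

  Defined : Maybe Val → Set
  Defined m = ∃[ v ] m ≡ just v

  updA : Intf → Act → Val → Intf
  updA I a v = record I { act = λ b → if does (b ≟A a) then just v else act I b }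

  data Net : Set where
    𝟎    : Net
    node : Name → Intf → Proc 0 0 → Mob → Loc → Net
    _∣_  : Net → Net → Net
    ν    : Chan → Net → Net

  infixr 4 _∣_

  occP : ∀ {n p} → Chan → Proc n p → Set
  occP c nil            = ⊥
  occP c (tick P)       = occP c P
  occP c (atx P)        = occP c P
  occP c (sread s P)    = occP c P
  occP c (awrite a t P) = occP c P
  occP c (P ∥ Q)        = occP c P ⊎ occP c Q
  occP c (outT d t P Q) = (c ≡ d) ⊎ (occP c P ⊎ occP c Q)
  occP c (inT d P Q)    = (c ≡ d) ⊎ (occP c P ⊎ occP c Q)
  occP c (cond b P Q)   = occP c P ⊎ occP c Q
  occP c (pvar X)       = ⊥
  occP c (fix P)        = occP c P

  occN : Chan → Net → Set
  occN c 𝟎              = ⊥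
  occN c (node n I P μ h) = occP c P
  occN c (M ∣ N)        = occN c M ⊎ occN c N
  occN c (ν d M)        = c ≢ d × occN c M

  data _≡P_ : ∀ {n p} → Proc n p → Proc n p → Set where
    reflP  : ∀ {n p} {P : Proc n p} → P ≡P P
    symP   : ∀ {n p} {P Q : Proc n p} → P ≡P Q → Q ≡P P
    transP : ∀ {n p} {P Q R : Proc n p} → P ≡P Q → Q ≡P R → P ≡P R
    tickC   : ∀ {n p} {P P' : Proc n p} → P ≡P P' → tick P ≡P tick P'
    atxC    : ∀ {n p} {P P' : Proc (suc n) p} → P ≡P P' → atx P ≡P atx P'
    sreadC  : ∀ {n p s} {P P' : Proc (suc n) p} → P ≡P P' → sread s P ≡P sread s P'
    awriteC : ∀ {n p a t} {P P' : Proc n p} → P ≡P P' → awrite a t P ≡P awrite a t P'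
    parC    : ∀ {n p} {P P' Q Q' : Proc n p} → P ≡P P' → Q ≡P Q' → (P ∥ Q) ≡P (P' ∥ Q')
    outC    : ∀ {n p c t} {P P' Q Q' : Proc n p} → P ≡P P' → Q ≡P Q' →
              outT c t P Q ≡P outT c t P' Q'
    inC     : ∀ {n p c} {P P' : Proc (suc n) p} {Q Q' : Proc n p} → P ≡P P' → Q ≡P Q' →
              inT c P Q ≡P inT c P' Q'
    condC   : ∀ {n p b} {P P' Q Q' : Proc n p} → P ≡P P' → Q ≡P Q' →
              cond b P Q ≡P cond b P' Q'
    fixC    : ∀ {n p} {P P' : Proc n (suc p)} → P ≡P P' → fix P ≡P fix P'
    parComm  : ∀ {n p} {P Q : Proc n p} → (P ∥ Q) ≡P (Q ∥ P)
    parAssoc : ∀ {n p} {P Q R : Proc n p} → ((P ∥ Q) ∥ R) ≡P (P ∥ (Q ∥ R))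
    parUnit  : ∀ {n p} {P : Proc n p} → (P ∥ nil) ≡P P
    condT    : ∀ {p} {b : Guard 0} {P Q : Proc 0 p} → b (λ ()) ≡ true → cond b P Q ≡P P
    condF    : ∀ {p} {b : Guard 0} {P Q : Proc 0 p} → b (λ ()) ≡ false → cond b P Q ≡P Q
    fixU     : ∀ {n p} {P : Proc n (suc p)} → fix P ≡P unfold P

  data _≡N_ : Net → Net → Set where
    reflN  : ∀ {M} → M ≡N M
    symN   : ∀ {M N} → M ≡N N → N ≡N M
    transN : ∀ {M N L} → M ≡N N → N ≡N L → M ≡N L
    nodeC  : ∀ {n I P P' μ h} → P ≡P P' → node n I P μ h ≡N node n I P' μ h
    barC   : ∀ {M M' N N'} → M ≡N M' → N ≡N N' → (M ∣ N) ≡N (M' ∣ N')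
    νC     : ∀ {c M M'} → M ≡N M' → ν c M ≡N ν c M'
    barComm  : ∀ {M N} → (M ∣ N) ≡N (N ∣ M)
    barAssoc : ∀ {M N L} → ((M ∣ N) ∣ L) ≡N (M ∣ (N ∣ L))
    barUnit  : ∀ {M} → (M ∣ 𝟎) ≡N M
    νZero    : ∀ {c} → ν c 𝟎 ≡N 𝟎
    νSwap    : ∀ {c d M} → ν c (ν d M) ≡N ν d (ν c M)
    νExtr    : ∀ {c M N} → ¬ occN c M → ν c (M ∣ N) ≡N (M ∣ ν c N)

  data ILab : Set where
    τ  : ILab
    aL : Act → ILab

  record NodeSt : Set where
    constructor st
    field
      intf : Intf
      proc : Proc 0 0
      mob  : Mob
      here : Loc

  prodN : ∀ {k} → Vec Name k → Vec NodeSt k → Net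
  prodN [] [] = 𝟎
  prodN (n ∷ ns) (st I P μ h ∷ xs) = node n I P μ h ∣ prodN ns xs

  addQ : ∀ {k} → Vec NodeSt k → Vec (Proc 0 0) k → Vec NodeSt k
  addQ [] [] = []
  addQ (st I P μ h ∷ xs) (Q ∷ qs) = st I (P ∥ Q) μ h ∷ addQ xs qs

  data _⟶[_]_ : Net → ILab → Net → Set where
    pos      : ∀ {n I P μ h} →
               node n I (atx P) μ h ⟶[ τ ] node n I (P [ loc h ]) μ h
    sensread : ∀ {n I s v P μ h} → sens I s ≡ just v →
               node n I (sread s P) μ h ⟶[ τ ] node n I (P [ v ]) μ h
    actunchg : ∀ {n I a v P μ h} → act I a ≡ just v →
               node n I (awrite a (val v) P) μ h ⟶[ τ ] node n I P μ h
    actchg   : ∀ {n I a v P μ h} → act I a ≢ just v →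
               node n I (awrite a (val v) P) μ h ⟶[ aL a ] node n (updA I a v) P μ h
    loccom   : ∀ {n I c v P R Q S μ h} → rng c ≡ local →
               node n I (outT c (val v) P R ∥ inT c Q S) μ h ⟶[ τ ]
               node n I (P ∥ (Q [ v ])) μ h
    glbcom   : ∀ {n m I J c v P R Q S μ₁ μ₂ h k} → dist h k ≤R rng c →
               (node n I (outT c (val v) P R) μ₁ h ∣ node m J (inT c Q S) μ₂ k) ⟶[ τ ]
               (node n I P μ₁ h ∣ node m J (Q [ v ]) μ₂ k)
    parp     : ∀ {k ω} (ns : Vec Name k) (xs ys : Vec NodeSt k) (qs : Vec (Proc 0 0) k) →
               prodN ns xs ⟶[ ω ] prodN ns ys →
               prodN ns (addQ xs qs) ⟶[ ω ] prodN ns (addQ ys qs)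
    parn     : ∀ {M M' N ω} → M ⟶[ ω ] M' → (M ∣ N) ⟶[ ω ] (M' ∣ N)
    res      : ∀ {c M N ω} → M ⟶[ ω ] N → ν c M ⟶[ ω ] ν c N
    struct   : ∀ {M N N' M' ω} → M ≡N N → N ⟶[ ω ] N' → N' ≡N M' → M ⟶[ ω ] M'

  data _⟶i^_,_ : Net → ℕ → Net → Set where
    done : ∀ {M} → M ⟶i^ 0 , M
    step : ∀ {M M' N u ω} → M ⟶[ ω ] M' → M' ⟶i^ u , N → M ⟶i^ suc u , N

  nodes : Net → List (Name × NodeSt)
  nodes 𝟎                = []
  nodes (node n I P μ h) = (n , st I P μ h) ∷ []
  nodes (M ∣ N)          = nodes M ++ nodes N
  nodes (ν c M)          = nodes M

  UsesOK : ∀ {n p} → Intf → Proc n p → Set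
  UsesOK I nil            = ⊤
  UsesOK I (tick P)       = UsesOK I P
  UsesOK I (atx P)        = UsesOK I P
  UsesOK I (sread s P)    = Defined (sens I s) × UsesOK I P
  UsesOK I (awrite a t P) = Defined (act I a) × UsesOK I P
  UsesOK I (P ∥ Q)        = UsesOK I P × UsesOK I Q
  UsesOK I (outT c t P Q) = UsesOK I P × UsesOK I Q
  UsesOK I (inT c P Q)    = UsesOK I P × UsesOK I Q
  UsesOK I (cond b P Q)   = UsesOK I P × UsesOK I Q
  UsesOK I (pvar X)       = ⊤
  UsesOK I (fix P)        = UsesOK I P

  WFNet : Net → Set
  WFNet M =
    let ns = nodes M
        nm = λ (i : Fin (length ns)) → proj₁ (lookup ns i)
        ns' = λ (i : Fin (length ns)) → proj₂ (lookup ns i)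
        I  = λ i → NodeSt.intf (ns' i)
    in (∀ i j → i ≢ j → nm i ≢ nm j)
     × (∀ i j → i ≢ j → ∀ a → ¬ (Defined (act (I i) a) × Defined (act (I j) a)))
     × (∀ i j → i ≢ j → ∀ s → locDep s ≡ false →
          ¬ (Defined (sens (I i) s) × Defined (sens (I j) s)))
     × (∀ i s → locDep s ≡ true → Defined (sens (I i) s) → NodeSt.mob (ns' i) ≡ stat)
     × (∀ i → UsesOK (I i) (NodeSt.proc (ns' i)))
     × (∀ i → WFP (NodeSt.proc (ns' i)))

-- A process can only perform finitely many instantaneous reductions before it has to let time
-- pass: prefixes cost one reduction each, parallel components add up, σ.Q and the timeout branch
-- Q of ⌊π.P⌋Q cost nothing, and recursion is bounded because recursion variables are time-guarded.
-- We make this precise as a predicate "P is bounded by k" on processes, lifted additively to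
-- networks. It is invariant under structural congruence, including the unfolding of fix, which
-- is why bounds of open processes are taken relative to bounds assumed for their process
-- variables; and every instantaneous reduction turns a bound k into a bound k - 1.
module Submission where

open import Defs
open import Data.Nat using (ℕ; _≤_)
open import Data.Product using (∃-syntax)

open import Level using (0ℓ)
open import Data.Nat using (zero; suc; _+_; z≤n; s≤s)
open import Data.Nat.Properties
  using (≤-refl; ≤-trans; ≤-reflexive; +-comm; +-assoc; +-identityʳ; +-monoˡ-≤; +-monoʳ-≤; m≤m+n; m≤n+m; n≤1+n)
open import Data.Fin using (Fin; zero; suc)
open import Data.Bool using (true; false; if_then_else_)
open import Data.Product using (_×_; _,_; proj₁; proj₂; ∃₂)
open import Data.Sum using (_⊎_; inj₁; inj₂; map₁)
open import Data.Empty using (⊥-elim)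
open import Data.Unit using (tt)
open import Data.List.Properties using (tabulate-lookup)
open import Data.List.Relation.Unary.All using (All; []; _∷_)
open import Data.List.Relation.Unary.All.Properties using (++⁻; tabulate⁺)
open import Data.Vec using (Vec; []; _∷_)
open import Data.Vec.Functional using (Vector) renaming (_∷_ to _∷ᶜ_)
open import Function using (id; _∘_)
open import Relation.Unary using (Pred; _⊆_; _≐_; _∩_; _∪_; U)
open import Relation.Unary.Properties using (≐-refl; ≐-sym; ≐-trans)
open import Relation.Nullary.Construct.Add.Supremum using (_⁺; ⊤⁺; [_])
open import Relation.Binary.Construct.Add.Supremum.NonStrict _≤_ using (_≤⁺_; [_]; _≤⊤⁺; ≤⁺-trans; ≤⁺-reflexive-≡)
open import Relation.Binary.PropositionalEquality using (_≡_; refl; sym; cong; subst)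

private
  variable
    A A′ B B′ C D E : Pred ℕ 0ℓ

UpClosed : Pred ℕ 0ℓ → Set
UpClosed A = ∀ {j k} → j ≤ k → A j → A k

infixr 6 _⊕_

_⊕_ : Pred ℕ 0ℓ → Pred ℕ 0ℓ → Pred ℕ 0ℓ
(A ⊕ B) k = ∃₂ λ a b → a + b ≤ k × A a × B b

⊕-upClosed : UpClosed (A ⊕ B)
⊕-upClosed j≤k (a , b , a+b≤j , x , y) = a , b , ≤-trans a+b≤j j≤k , x , y

⊕-map : A ⊆ A′ → B ⊆ B′ → A ⊕ B ⊆ A′ ⊕ B′
⊕-map f g (a , b , a+b≤k , x , y) = a , b , a+b≤k , f x , g y

⊕-cong : A ≐ A′ → B ≐ B′ → A ⊕ B ≐ A′ ⊕ B′
⊕-cong (f , f⁻) (g , g⁻) = ⊕-map f g , ⊕-map f⁻ g⁻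

⊕-comm : A ⊕ B ⊆ B ⊕ A
⊕-comm (a , b , a+b≤k , x , y) = b , a , ≤-trans (≤-reflexive (+-comm b a)) a+b≤k , y , x

⊕-assoc : (A ⊕ B) ⊕ C ⊆ A ⊕ (B ⊕ C)
⊕-assoc (_ , c , ab+c≤k , (a , b , a+b≤ab , x , y) , z) =
  a , b + c , ≤-trans (≤-reflexive (sym (+-assoc a b c))) (≤-trans (+-monoˡ-≤ c a+b≤ab) ab+c≤k) ,
  x , (b , c , ≤-refl , y , z)

⊕-assoc⁻ : A ⊕ (B ⊕ C) ⊆ (A ⊕ B) ⊕ C
⊕-assoc⁻ (a , _ , a+bc≤k , x , (b , c , b+c≤bc , y , z)) =
  a + b , c , ≤-trans (≤-reflexive (+-assoc a b c)) (≤-trans (+-monoʳ-≤ a b+c≤bc) a+bc≤k) ,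
  (a , b , ≤-refl , x , y) , z

⊕-identityʳ : UpClosed A → A ⊕ U ≐ A
⊕-identityʳ up = (λ (a , b , a+b≤k , x , _) → up (≤-trans (m≤m+n a b) a+b≤k) x)
               , (λ {k} x → k , 0 , ≤-reflexive (+-identityʳ k) , x , tt)

⊕-interchange : (A ⊕ B) ⊕ (C ⊕ D) ⊆ (A ⊕ C) ⊕ (B ⊕ D)
⊕-interchange = ⊕-assoc⁻ ∘ ⊕-map id (⊕-assoc ∘ ⊕-map ⊕-comm id ∘ ⊕-assoc⁻) ∘ ⊕-assoc

⊕-∪ : UpClosed E → (E ∪ A) ⊕ (E ∪ B) ⊆ E ∪ (A ⊕ B)
⊕-∪ up (a , b , a+b≤k , inj₁ e , _) = inj₁ (up (≤-trans (m≤m+n a b) a+b≤k) e)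
⊕-∪ up (a , b , a+b≤k , inj₂ _ , inj₁ e) = inj₁ (up (≤-trans (m≤n+m b a) a+b≤k) e)
⊕-∪ up (a , b , a+b≤k , inj₂ x , inj₂ y) = inj₂ (a , b , a+b≤k , x , y)

×-⊎ : ∀ {E X Y : Set} → (E ⊎ X) × (E ⊎ Y) → E ⊎ (X × Y)
×-⊎ (inj₁ e , _)      = inj₁ e
×-⊎ (inj₂ _ , inj₁ e) = inj₁ e
×-⊎ (inj₂ x , inj₂ y) = inj₂ (x , y)

∩-cong : A ≐ A′ → B ≐ B′ → A ∩ B ≐ A′ ∩ B′
∩-cong (f , f⁻) (g , g⁻) = (λ (x , y) → f x , g y) , (λ (x , y) → f⁻ x , g⁻ y)

data Next (A : Pred ℕ 0ℓ) : Pred ℕ 0ℓ where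
  next : ∀ {k} → A k → Next A (suc k)

Next-map : A ⊆ B → Next A ⊆ Next B
Next-map f (next x) = next (f x)

Next-cong : A ≐ B → Next A ≐ Next B
Next-cong (f , f⁻) = Next-map f , Next-map f⁻

Next-upClosed : UpClosed A → UpClosed (Next A)
Next-upClosed up (s≤s j≤k) (next x) = next (up j≤k x)

Next-⊆ : UpClosed A → Next A ⊆ A
Next-⊆ up (next {k} x) = up (n≤1+n k) x

Next-⊕ˡ : Next A ⊕ B ⊆ Next (A ⊕ B)
Next-⊕ˡ (suc a , b , s≤s a+b≤k , next x , y) = next (a , b , a+b≤k , x , y)

Next-∪ : UpClosed E → Next (E ∪ A) ⊆ E ∪ Next A
Next-∪ up (next {k} (inj₁ e)) = inj₁ (up (n≤1+n k) e)
Next-∪ up (next (inj₂ x))     = inj₂ (next x)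

data SelfBounded (F : ℕ → Pred ℕ 0ℓ) (k : ℕ) : Set where
  selfBounded : ∀ j → j ≤ k → F j j → SelfBounded F k

SelfBounded-map : ∀ {F G} → (∀ j → F j ⊆ G j) → SelfBounded F ⊆ SelfBounded G
SelfBounded-map f (selfBounded j j≤k x) = selfBounded j j≤k (f j x)

SelfBounded-cong : ∀ {F G} → (∀ j → F j ≐ G j) → SelfBounded F ≐ SelfBounded G
SelfBounded-cong f = SelfBounded-map (proj₁ ∘ f) , SelfBounded-map (proj₂ ∘ f)

if-map : ∀ b → A ⊆ A′ → B ⊆ B′ → (if b then A else B) ⊆ (if b then A′ else B′)
if-map true  f g = f
if-map false f g = g

if-cong : ∀ b → A ≐ A′ → B ≐ B′ → (if b then A else B) ≐ (if b then A′ else B′)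
if-cong b (f , f⁻) (g , g⁻) = if-map b f g , if-map b f⁻ g⁻

if-upClosed : ∀ b → UpClosed A → UpClosed B → UpClosed (if b then A else B)
if-upClosed true  upA upB = upA
if-upClosed false upA upB = upB

if-∪ : ∀ b → A′ ⊆ E ∪ A → B′ ⊆ E ∪ B → (if b then A′ else B′) ⊆ E ∪ (if b then A else B)
if-∪ true  f g = f
if-∪ false f g = g

if-true : ∀ {b} → b ≡ true → (if b then A else B) ≐ A
if-true refl = ≐-refl

if-false : ∀ {b} → b ≡ false → (if b then A else B) ≐ B
if-false refl = ≐-refl

∩⊆if : ∀ b → A ∩ B ⊆ (if b then A else B)
∩⊆if true  = proj₁
∩⊆if false = proj₂

module Bounds (Π : Params) where
  open Params Π
  open CaIT Π hiding (_[_])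

  Cost : ℕ → Set
  Cost = Vector (ℕ ⁺)

  forbidden : ∀ {p} → Cost p
  forbidden _ = ⊤⁺

  -- Bound η P k: P performs at most k instantaneous reductions before it has to let time pass,
  -- provided each process variable X stands for a process with bound η X; ⊤⁺ forbids X to occur
  -- unguarded. Below a value binder every variable is forbidden, which makes bounds stable under
  -- value substitution; a closed conditional is decided, as in ≡P, an open one needs both branches.
  -- fix X.P is bounded by k if P has some bound j ≤ k when X is assumed to have bound j.
  Bound : ∀ {n p} → Cost p → Proc n p → Pred ℕ 0ℓ
  Bound η nil            = U
  Bound η (tick P)       = U
  Bound η (atx P)        = Next (Bound forbidden P)
  Bound η (sread s P)    = Next (Bound forbidden P)
  Bound η (awrite a t P) = Next (Bound η P)
  Bound η (P ∥ Q)        = Bound η P ⊕ Bound η Q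
  Bound η (outT c t P Q) = Next (Bound η P)
  Bound η (inT c P Q)    = Next (Bound forbidden P)
  Bound {zero}  η (cond b P Q) = if b (λ ()) then Bound η P else Bound η Q
  Bound {suc n} η (cond b P Q) = Bound η P ∩ Bound η Q
  Bound η (pvar X)       = λ k → η X ≤⁺ [ k ]
  Bound η (fix P)        = SelfBounded (λ j → Bound ([ j ] ∷ᶜ η) P)

  Bound-cond-both : ∀ {n p} (η : Cost p) b (P Q : Proc n p) → Bound η P ∩ Bound η Q ⊆ Bound η (cond b P Q)
  Bound-cond-both {zero}  η b P Q = ∩⊆if (b (λ ()))
  Bound-cond-both {suc n} η b P Q = id

  Bound-upClosed : ∀ {n p} (η : Cost p) (P : Proc n p) → UpClosed (Bound η P)
  Bound-upClosed η nil            _ _ = tt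
  Bound-upClosed η (tick P)       _ _ = tt
  Bound-upClosed η (atx P)        = Next-upClosed (Bound-upClosed forbidden P)
  Bound-upClosed η (sread s P)    = Next-upClosed (Bound-upClosed forbidden P)
  Bound-upClosed η (awrite a t P) = Next-upClosed (Bound-upClosed η P)
  Bound-upClosed η (P ∥ Q)        = ⊕-upClosed
  Bound-upClosed η (outT c t P Q) = Next-upClosed (Bound-upClosed η P)
  Bound-upClosed η (inT c P Q)    = Next-upClosed (Bound-upClosed forbidden P)
  Bound-upClosed {zero} η (cond b P Q) = if-upClosed (b (λ ())) (Bound-upClosed η P) (Bound-upClosed η Q)
  Bound-upClosed {suc n} η (cond b P Q) j≤k (x , y) = Bound-upClosed η P j≤k x , Bound-upClosed η Q j≤k y
  Bound-upClosed η (pvar X)       j≤k ηX≤j = ≤⁺-trans ≤-trans ηX≤j [ j≤k ]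
  Bound-upClosed η (fix P)        j≤k (selfBounded i i≤j x) = selfBounded i (≤-trans i≤j j≤k) x

  _≤ᶜ_ : ∀ {p} → Cost p → Cost p → Set
  η ≤ᶜ η′ = ∀ X → η X ≤⁺ η′ X

  ∷-≤ᶜ : ∀ {p} {η η′ : Cost p} x → η ≤ᶜ η′ → (x ∷ᶜ η) ≤ᶜ (x ∷ᶜ η′)
  ∷-≤ᶜ x η≤η′ zero    = ≤⁺-reflexive-≡ ≤-reflexive refl
  ∷-≤ᶜ x η≤η′ (suc X) = η≤η′ X

  Bound-antitone : ∀ {n p} {η η′ : Cost p} → η′ ≤ᶜ η → (P : Proc n p) → Bound η P ⊆ Bound η′ P
  Bound-antitone η′≤η nil            = id
  Bound-antitone η′≤η (tick P)       = id
  Bound-antitone η′≤η (atx P)        = id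
  Bound-antitone η′≤η (sread s P)    = id
  Bound-antitone η′≤η (awrite a t P) = Next-map (Bound-antitone η′≤η P)
  Bound-antitone η′≤η (P ∥ Q)        = ⊕-map (Bound-antitone η′≤η P) (Bound-antitone η′≤η Q)
  Bound-antitone η′≤η (outT c t P Q) = Next-map (Bound-antitone η′≤η P)
  Bound-antitone η′≤η (inT c P Q)    = id
  Bound-antitone {zero}  η′≤η (cond b P Q) = if-map (b (λ ())) (Bound-antitone η′≤η P) (Bound-antitone η′≤η Q)
  Bound-antitone {suc n} η′≤η (cond b P Q) (x , y) = Bound-antitone η′≤η P x , Bound-antitone η′≤η Q y
  Bound-antitone η′≤η (pvar X)       = ≤⁺-trans ≤-trans (η′≤η X)
  Bound-antitone η′≤η (fix P)        = SelfBounded-map (λ j → Bound-antitone (∷-≤ᶜ [ j ] η′≤η) P)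

  ∷-extR : ∀ {p q} {η : Cost p} {η′ : Cost q} {r : Fin p → Fin q} x →
           (∀ X → η′ (r X) ≡ η X) → ∀ X → (x ∷ᶜ η′) (extR r X) ≡ (x ∷ᶜ η) X
  ∷-extR x ηr≡η zero    = refl
  ∷-extR x ηr≡η (suc X) = ηr≡η X

  Bound-prename : ∀ {n p q} (r : Fin p → Fin q) {η : Cost p} {η′ : Cost q} →
                  (∀ X → η′ (r X) ≡ η X) → (P : Proc n p) → Bound η P ≐ Bound η′ (prename r P)
  Bound-prename r ηr≡η nil            = ≐-refl
  Bound-prename r ηr≡η (tick P)       = ≐-refl
  Bound-prename r ηr≡η (atx P)        = Next-cong (Bound-prename r (λ _ → refl) P)
  Bound-prename r ηr≡η (sread s P)    = Next-cong (Bound-prename r (λ _ → refl) P)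
  Bound-prename r ηr≡η (awrite a t P) = Next-cong (Bound-prename r ηr≡η P)
  Bound-prename r ηr≡η (P ∥ Q)        = ⊕-cong (Bound-prename r ηr≡η P) (Bound-prename r ηr≡η Q)
  Bound-prename r ηr≡η (outT c t P Q) = Next-cong (Bound-prename r ηr≡η P)
  Bound-prename r ηr≡η (inT c P Q)    = Next-cong (Bound-prename r (λ _ → refl) P)
  Bound-prename {zero} r ηr≡η (cond b P Q) =
    if-cong (b (λ ())) (Bound-prename r ηr≡η P) (Bound-prename r ηr≡η Q)
  Bound-prename {suc n} r ηr≡η (cond b P Q) =
    ∩-cong (Bound-prename r ηr≡η P) (Bound-prename r ηr≡η Q)
  Bound-prename r ηr≡η (pvar X)       =
    subst (_≤⁺ [ _ ]) (sym (ηr≡η X)) , subst (_≤⁺ [ _ ]) (ηr≡η X)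
  Bound-prename r ηr≡η (fix P)        =
    SelfBounded-cong (λ j → Bound-prename (extR r) (∷-extR [ j ] ηr≡η) P)

  Bound-weaken : ∀ {n p} {η : Cost p} x (P : Proc n p) → Bound η P ≐ Bound (x ∷ᶜ η) (prename suc P)
  Bound-weaken x = Bound-prename suc (λ _ → refl)

  Bound-vsub : ∀ {n m p} (s : Fin (suc n) → Tm m) (η : Cost p) (P : Proc (suc n) p) →
               Bound η P ⊆ Bound η (vsub s P)
  Bound-vsub s η nil            = id
  Bound-vsub s η (tick P)       = id
  Bound-vsub s η (atx P)        = Next-map (Bound-vsub (extV s) forbidden P)
  Bound-vsub s η (sread x P)    = Next-map (Bound-vsub (extV s) forbidden P)
  Bound-vsub s η (awrite a t P) = Next-map (Bound-vsub s η P)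
  Bound-vsub s η (P ∥ Q)        = ⊕-map (Bound-vsub s η P) (Bound-vsub s η Q)
  Bound-vsub s η (outT c t P Q) = Next-map (Bound-vsub s η P)
  Bound-vsub s η (inT c P Q)    = Next-map (Bound-vsub (extV s) forbidden P)
  Bound-vsub s η (cond b P Q) (x , y) =
    Bound-cond-both η (substG s b) (vsub s P) (vsub s Q) (Bound-vsub s η P x , Bound-vsub s η Q y)
  Bound-vsub s η (pvar X)       = id
  Bound-vsub s η (fix P)        = SelfBounded-map (λ j → Bound-vsub s ([ j ] ∷ᶜ η) P)

  Bound-vsub⁻ : ∀ {n m p} (s : Fin n → Tm (suc m)) (η : Cost p) (P : Proc n p) →
                Bound η (vsub s P) ⊆ Bound η P
  Bound-vsub⁻ s η nil            = id
  Bound-vsub⁻ s η (tick P)       = id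
  Bound-vsub⁻ s η (atx P)        = Next-map (Bound-vsub⁻ (extV s) forbidden P)
  Bound-vsub⁻ s η (sread x P)    = Next-map (Bound-vsub⁻ (extV s) forbidden P)
  Bound-vsub⁻ s η (awrite a t P) = Next-map (Bound-vsub⁻ s η P)
  Bound-vsub⁻ s η (P ∥ Q)        = ⊕-map (Bound-vsub⁻ s η P) (Bound-vsub⁻ s η Q)
  Bound-vsub⁻ s η (outT c t P Q) = Next-map (Bound-vsub⁻ s η P)
  Bound-vsub⁻ s η (inT c P Q)    = Next-map (Bound-vsub⁻ (extV s) forbidden P)
  Bound-vsub⁻ s η (cond b P Q) (x , y) =
    Bound-cond-both η b P Q (Bound-vsub⁻ s η P x , Bound-vsub⁻ s η Q y)
  Bound-vsub⁻ s η (pvar X)       = id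
  Bound-vsub⁻ s η (fix P)        = SelfBounded-map (λ j → Bound-vsub⁻ s ([ j ] ∷ᶜ η) P)

  Bound-psub : ∀ {n p q} (f : Fin p → Proc n q) {η : Cost p} {η′ : Cost q} →
               (∀ X → Bound η (pvar {n} X) ⊆ Bound η′ (f X)) →
               (P : Proc n p) → Bound η P ⊆ Bound η′ (psub f P)
  Bound-psub f hyp nil            = id
  Bound-psub f hyp (tick P)       = id
  Bound-psub f hyp (atx P)        = Next-map (Bound-psub (vweaken ∘ f) {forbidden} (λ _ ()) P)
  Bound-psub f hyp (sread s P)    = Next-map (Bound-psub (vweaken ∘ f) {forbidden} (λ _ ()) P)
  Bound-psub f hyp (awrite a t P) = Next-map (Bound-psub f hyp P)
  Bound-psub f hyp (P ∥ Q)        = ⊕-map (Bound-psub f hyp P) (Bound-psub f hyp Q)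
  Bound-psub f hyp (outT c t P Q) = Next-map (Bound-psub f hyp P)
  Bound-psub f hyp (inT c P Q)    = Next-map (Bound-psub (vweaken ∘ f) {forbidden} (λ _ ()) P)
  Bound-psub {zero} f hyp (cond b P Q) = if-map (b (λ ())) (Bound-psub f hyp P) (Bound-psub f hyp Q)
  Bound-psub {suc n} f hyp (cond b P Q) (x , y) = Bound-psub f hyp P x , Bound-psub f hyp Q y
  Bound-psub f hyp (pvar X)       = hyp X
  Bound-psub {n} f {η} {η′} hyp (fix P) = SelfBounded-map (λ j → Bound-psub (extP f) (hyp′ j) P)
    where
    hyp′ : ∀ j X → Bound ([ j ] ∷ᶜ η) (pvar {n} X) ⊆ Bound ([ j ] ∷ᶜ η′) (extP f X)
    hyp′ j zero    = λ x → x
    hyp′ j (suc X) = proj₁ (Bound-weaken [ j ] (f X)) ∘ hyp X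

  data Escape {n p q} (f : Fin p → Proc n q) (η : Cost p) (η′ : Cost q) (k : ℕ) : Set where
    escape : ∀ X → η X ≡ ⊤⁺ → Bound η′ (f X) k → Escape f η η′ k

  Escape-upClosed : ∀ {n p q} {f : Fin p → Proc n q} {η η′} → UpClosed (Escape f η η′)
  Escape-upClosed {f = f} {η′ = η′} j≤k (escape X ηX≡⊤ x) = escape X ηX≡⊤ (Bound-upClosed η′ (f X) j≤k x)

  CostRenaming : ∀ {n p q} → (Fin p → Proc n q) → Cost p → Cost q → Set
  CostRenaming f η η′ = ∀ X → (∃[ Y ] f X ≡ pvar Y × η X ≡ η′ Y) ⊎ η X ≡ ⊤⁺

  CostRenaming-extP : ∀ {n p q} {f : Fin p → Proc n q} {η η′} x →
                      CostRenaming f η η′ → CostRenaming (extP f) (x ∷ᶜ η) (x ∷ᶜ η′)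
  CostRenaming-extP x ren zero    = inj₁ (zero , refl , refl)
  CostRenaming-extP x ren (suc X) with ren X
  ... | inj₁ (Y , fX≡Y , ηX≡η′Y) = inj₁ (suc Y , cong (prename suc) fX≡Y , ηX≡η′Y)
  ... | inj₂ ηX≡⊤                = inj₂ ηX≡⊤

  Escape-vweaken : ∀ {n p q} {f : Fin p → Proc n q} {η η′} → CostRenaming f η η′ →
                   Escape (vweaken ∘ f) forbidden forbidden ⊆ Escape f η η′
  Escape-vweaken {f = f} {η′ = η′} ren (escape X _ x) with ren X
  ... | inj₂ ηX≡⊤ = escape X ηX≡⊤ (Bound-antitone (λ _ → _ ≤⊤⁺) (f X) (Bound-vsub⁻ _ forbidden (f X) x))
  ... | inj₁ (Y , fX≡Y , _) with subst (λ R → Bound forbidden (vweaken R) _) fX≡Y x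
  ...   | ()

  Escape-extP : ∀ {n p q} {f : Fin p → Proc n q} {η η′} j →
                Escape (extP f) ([ j ] ∷ᶜ η) ([ j ] ∷ᶜ η′) ⊆ Escape f η η′
  Escape-extP {f = f} j (escape (suc X) ηX≡⊤ x) = escape X ηX≡⊤ (proj₂ (Bound-weaken [ j ] (f X)) x)

  Bound-psub⁻ : ∀ {n p q} (f : Fin p → Proc n q) {η : Cost p} {η′ : Cost q} →
                CostRenaming f η η′ → (P : Proc n p) →
                Bound η′ (psub f P) ⊆ Escape f η η′ ∪ Bound η P
  Bound-psub⁻-binder : ∀ {n p q} (f : Fin p → Proc n q) {η : Cost p} {η′ : Cost q} →
                       CostRenaming f η η′ → (P : Proc (suc n) p) →
                       Next (Bound forbidden (psub (vweaken ∘ f) P)) ⊆ Escape f η η′ ∪ Next (Bound forbidden P)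

  Bound-psub⁻ f ren nil            _ = inj₂ tt
  Bound-psub⁻ f ren (tick P)       _ = inj₂ tt
  Bound-psub⁻ f ren (atx P)        = Bound-psub⁻-binder f ren P
  Bound-psub⁻ f ren (sread s P)    = Bound-psub⁻-binder f ren P
  Bound-psub⁻ f ren (awrite a t P) = Next-∪ Escape-upClosed ∘ Next-map (Bound-psub⁻ f ren P)
  Bound-psub⁻ f ren (P ∥ Q)        = ⊕-∪ Escape-upClosed ∘ ⊕-map (Bound-psub⁻ f ren P) (Bound-psub⁻ f ren Q)
  Bound-psub⁻ f ren (outT c t P Q) = Next-∪ Escape-upClosed ∘ Next-map (Bound-psub⁻ f ren P)
  Bound-psub⁻ f ren (inT c P Q)    = Bound-psub⁻-binder f ren P
  Bound-psub⁻ {zero} f ren (cond b P Q) = if-∪ (b (λ ())) (Bound-psub⁻ f ren P) (Bound-psub⁻ f ren Q)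
  Bound-psub⁻ {suc n} f ren (cond b P Q) (x , y) = ×-⊎ (Bound-psub⁻ f ren P x , Bound-psub⁻ f ren Q y)
  Bound-psub⁻ f ren (pvar X) x with ren X
  ... | inj₁ (Y , fX≡Y , ηX≡η′Y) =
    inj₂ (subst (_≤⁺ [ _ ]) (sym ηX≡η′Y) (subst (λ R → Bound _ R _) fX≡Y x))
  ... | inj₂ ηX≡⊤                = inj₁ (escape X ηX≡⊤ x)
  Bound-psub⁻ f ren (fix P) (selfBounded j j≤k x)
    with Bound-psub⁻ (extP f) (CostRenaming-extP [ j ] ren) P x
  ... | inj₁ e = inj₁ (Escape-upClosed j≤k (Escape-extP j e))
  ... | inj₂ y = inj₂ (selfBounded j j≤k y)

  Bound-psub⁻-binder f ren P =
    Next-∪ Escape-upClosed ∘ Next-map (map₁ (Escape-vweaken ren) ∘ Bound-psub⁻ (vweaken ∘ f) (λ _ → inj₂ refl) P)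

  Bound-unfold : ∀ {n p} (η : Cost p) (P : Proc n (suc p)) → Bound η (fix P) ≐ Bound η (unfold P)
  Bound-unfold {n} η P = fold⊆unfold , unfold⊆fold
    where
    fold⊆unfold : Bound η (fix P) ⊆ Bound η (unfold P)
    fold⊆unfold (selfBounded j j≤k x) =
      Bound-psub (single (fix P)) recursion P (Bound-upClosed ([ j ] ∷ᶜ η) P j≤k x)
      where
      recursion : ∀ X → Bound ([ j ] ∷ᶜ η) (pvar {n} X) ⊆ Bound η (single (fix P) X)
      recursion zero    [ j≤i ] = selfBounded j j≤i x
      recursion (suc X) ηX≤i    = ηX≤i

    recursionVar : CostRenaming (single (fix P)) (⊤⁺ ∷ᶜ η) η
    recursionVar zero    = inj₂ refl
    recursionVar (suc X) = inj₁ (X , refl , refl)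

    costs : ∀ k → ([ k ] ∷ᶜ η) ≤ᶜ (⊤⁺ ∷ᶜ η)
    costs k zero    = _ ≤⊤⁺
    costs k (suc X) = ≤⁺-reflexive-≡ ≤-reflexive refl

    unfold⊆fold : Bound η (unfold P) ⊆ Bound η (fix P)
    unfold⊆fold {k} x with Bound-psub⁻ (single (fix P)) recursionVar P x
    ... | inj₂ y = selfBounded k ≤-refl (Bound-antitone (costs k) P y)
    ... | inj₁ (escape zero    _    y) = y
    ... | inj₁ (escape (suc X) ηX≡⊤ y) with subst (_≤⁺ [ k ]) ηX≡⊤ y
    ...   | ()

  Bound-≡P : ∀ {n p} {P Q : Proc n p} → P ≡P Q → ∀ η → Bound η P ≐ Bound η Q
  Bound-≡P reflP            η = ≐-refl
  Bound-≡P (symP e)         η = ≐-sym (Bound-≡P e η)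
  Bound-≡P (transP e e′)    η = ≐-trans (Bound-≡P e η) (Bound-≡P e′ η)
  Bound-≡P (tickC e)        η = ≐-refl
  Bound-≡P (atxC e)         η = Next-cong (Bound-≡P e forbidden)
  Bound-≡P (sreadC e)       η = Next-cong (Bound-≡P e forbidden)
  Bound-≡P (awriteC e)      η = Next-cong (Bound-≡P e η)
  Bound-≡P (parC e e′)      η = ⊕-cong (Bound-≡P e η) (Bound-≡P e′ η)
  Bound-≡P (outC e _)       η = Next-cong (Bound-≡P e η)
  Bound-≡P (inC e _)        η = Next-cong (Bound-≡P e forbidden)
  Bound-≡P {zero}  (condC {b = b} e e′) η = if-cong (b (λ ())) (Bound-≡P e η) (Bound-≡P e′ η)
  Bound-≡P {suc n} (condC e e′) η = ∩-cong (Bound-≡P e η) (Bound-≡P e′ η)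
  Bound-≡P (fixC e)         η = SelfBounded-cong (λ j → Bound-≡P e ([ j ] ∷ᶜ η))
  Bound-≡P parComm          η = ⊕-comm , ⊕-comm
  Bound-≡P parAssoc         η = ⊕-assoc , ⊕-assoc⁻
  Bound-≡P (parUnit {P = P}) η = ⊕-identityʳ (Bound-upClosed η P)
  Bound-≡P (condT b≡true)   η = if-true b≡true
  Bound-≡P (condF b≡false)  η = if-false b≡false
  Bound-≡P (fixU {P = P})   η = Bound-unfold η P

  -- Guarded variables never count, so the bound holds for every η; this lets fix X.P give X its own bound.
  Bound-wf : ∀ {n p} (P : Proc n p) → WFP P → (∀ X → TG X P) → ∃[ k ] ∀ η → Bound η P k
  Bound-wf nil            _ _ = 0 , λ _ → tt
  Bound-wf (tick P)       _ _ = 0 , λ _ → tt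
  Bound-wf (atx P)        wf tg = let k , b = Bound-wf P wf tg in suc k , λ _ → next (b forbidden)
  Bound-wf (sread s P)    wf tg = let k , b = Bound-wf P wf tg in suc k , λ _ → next (b forbidden)
  Bound-wf (awrite a t P) wf tg = let k , b = Bound-wf P wf tg in suc k , λ η → next (b η)
  Bound-wf (P ∥ Q) (wfP , wfQ) tg =
    let k , bP = Bound-wf P wfP (proj₁ ∘ tg) ; l , bQ = Bound-wf Q wfQ (proj₂ ∘ tg)
    in k + l , λ η → k , l , ≤-refl , bP η , bQ η
  Bound-wf (outT c t P Q) (wfP , _) tg = let k , b = Bound-wf P wfP tg in suc k , λ η → next (b η)
  Bound-wf (inT c P Q)    (wfP , _) tg = let k , b = Bound-wf P wfP tg in suc k , λ _ → next (b forbidden)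
  Bound-wf (cond g P Q) (wfP , wfQ) tg =
    let k , bP = Bound-wf P wfP (proj₁ ∘ tg) ; l , bQ = Bound-wf Q wfQ (proj₂ ∘ tg)
    in k + l , λ η → Bound-cond-both η g P Q
                       (Bound-upClosed η P (m≤m+n k l) (bP η) , Bound-upClosed η Q (m≤n+m l k) (bQ η))
  Bound-wf (pvar X)       _ tg = ⊥-elim (tg X refl)
  Bound-wf (fix P) (tg₀ , wf) tg = let k , b = Bound-wf P wf tg′ in k , λ η → selfBounded k ≤-refl (b ([ k ] ∷ᶜ η))
    where
    tg′ : ∀ X → TG X P
    tg′ zero    = tg₀
    tg′ (suc X) = tg X

  BoundN : Net → Pred ℕ 0ℓ
  BoundN 𝟎                = U
  BoundN (node _ _ P _ _) = Bound forbidden P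
  BoundN (M ∣ N)          = BoundN M ⊕ BoundN N
  BoundN (ν _ M)          = BoundN M

  BoundN-upClosed : ∀ M → UpClosed (BoundN M)
  BoundN-upClosed 𝟎                _ _ = tt
  BoundN-upClosed (node _ _ P _ _) = Bound-upClosed forbidden P
  BoundN-upClosed (M ∣ N)          = ⊕-upClosed
  BoundN-upClosed (ν _ M)          = BoundN-upClosed M

  BoundN-≡N : ∀ {M N} → M ≡N N → BoundN M ≐ BoundN N
  BoundN-≡N reflN          = ≐-refl
  BoundN-≡N (symN e)       = ≐-sym (BoundN-≡N e)
  BoundN-≡N (transN e e′)  = ≐-trans (BoundN-≡N e) (BoundN-≡N e′)
  BoundN-≡N (nodeC e)      = Bound-≡P e forbidden
  BoundN-≡N (barC e e′)    = ⊕-cong (BoundN-≡N e) (BoundN-≡N e′)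
  BoundN-≡N (νC e)         = BoundN-≡N e
  BoundN-≡N barComm        = ⊕-comm , ⊕-comm
  BoundN-≡N barAssoc       = ⊕-assoc , ⊕-assoc⁻
  BoundN-≡N (barUnit {M})  = ⊕-identityʳ (BoundN-upClosed M)
  BoundN-≡N νZero          = ≐-refl
  BoundN-≡N νSwap          = ≐-refl
  BoundN-≡N (νExtr _)      = ≐-refl

  BoundAll : ∀ {k} → Vec (Proc 0 0) k → Pred ℕ 0ℓ
  BoundAll []       = U
  BoundAll (Q ∷ Qs) = Bound forbidden Q ⊕ BoundAll Qs

  BoundN-addQ : ∀ {k} (ns : Vec Name k) (xs : Vec NodeSt k) (Qs : Vec (Proc 0 0) k) →
                BoundN (prodN ns (addQ xs Qs)) ≐ BoundN (prodN ns xs) ⊕ BoundAll Qs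
  BoundN-addQ []       []                 []       = (λ _ → 0 , 0 , z≤n , tt , tt) , (λ _ → tt)
  BoundN-addQ (n ∷ ns) (st I P μ h ∷ xs) (Q ∷ Qs) =
    ≐-trans (⊕-cong ≐-refl (BoundN-addQ ns xs Qs)) (⊕-interchange , ⊕-interchange)

  Bound-com : ∀ {n p q} (η : Cost p) (P : Proc n p) (Q : Proc (suc n) q) v →
              Next (Bound η P) ⊕ Next (Bound forbidden Q) ⊆ Next (Bound η P ⊕ Bound forbidden (vsub (sub0 v) Q))
  Bound-com η P Q v = Next-⊕ˡ ∘ ⊕-map id (Bound-vsub (sub0 v) forbidden Q ∘ Next-⊆ (Bound-upClosed forbidden Q))

  BoundN-⟶ : ∀ {M M′ ω} → M ⟶[ ω ] M′ → BoundN M ⊆ Next (BoundN M′)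
  BoundN-⟶ (pos {P = P} {h = h})        = Next-map (Bound-vsub (sub0 (loc h)) forbidden P)
  BoundN-⟶ (sensread {v = v} {P = P} _) = Next-map (Bound-vsub (sub0 v) forbidden P)
  BoundN-⟶ (actunchg _)                 = id
  BoundN-⟶ (actchg _)                   = id
  BoundN-⟶ (loccom {v = v} {P = P} {Q = Q} _) = Bound-com forbidden P Q v
  BoundN-⟶ (glbcom {v = v} {P = P} {Q = Q} _) = Bound-com forbidden P Q v
  BoundN-⟶ (parp ns xs ys Qs s)         =
    Next-map (proj₂ (BoundN-addQ ns ys Qs)) ∘ Next-⊕ˡ ∘ ⊕-map (BoundN-⟶ s) id ∘ proj₁ (BoundN-addQ ns xs Qs)
  BoundN-⟶ (parn s)                     = Next-⊕ˡ ∘ ⊕-map (BoundN-⟶ s) id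
  BoundN-⟶ (res s)                      = BoundN-⟶ s
  BoundN-⟶ (struct e s e′)              = Next-map (proj₁ (BoundN-≡N e′)) ∘ BoundN-⟶ s ∘ proj₁ (BoundN-≡N e)

  BoundN-⟶i^ : ∀ {M N u z} → M ⟶i^ u , N → BoundN M z → u ≤ z
  BoundN-⟶i^ done       _ = z≤n
  BoundN-⟶i^ (step s r) b with BoundN-⟶ s b
  ... | next b′ = s≤s (BoundN-⟶i^ r b′)

  BoundN-wf : ∀ M → All (WFP ∘ NodeSt.proc ∘ proj₂) (nodes M) → ∃[ z ] BoundN M z
  BoundN-wf 𝟎                _            = 0 , tt
  BoundN-wf (node _ _ P _ _) (wf ∷ [])    = let k , b = Bound-wf P wf (λ ()) in k , b forbidden
  BoundN-wf (M ∣ N)          wf           =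
    let wfM , wfN = ++⁻ (nodes M) wf ; k , bM = BoundN-wf M wfM ; l , bN = BoundN-wf N wfN
    in k + l , k , l , ≤-refl , bM , bN
  BoundN-wf (ν _ M)          wf           = BoundN-wf M wf

proposition4 : (Π : Params) → let open CaIT Π in
    (M : Net) → WFNet M →
    ∃[ z ] (∀ (u : ℕ) (N : Net) → M ⟶i^ u , N → u ≤ z)
proposition4 Π M (_ , _ , _ , _ , _ , wf) =
  let z , bound = BoundN-wf M (subst (All _) (tabulate-lookup (nodes M)) (tabulate⁺ wf))
  in z , λ _ _ run → BoundN-⟶i^ run bound
  where open Bounds Π
        open CaIT Π
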